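{- Let $G$ be a finite digraph, $P$ a finite poset and $k\ge 1$. If the $k$-walks of $G$ are $P$-colorable, then the $k'$-walks of $G$ are $P$-colorable for every $k'\ge k$.
   Context: A digraph has finite vertex set and edges that are ordered pairs of distinct vertices; write $u\to v$ for an edge. A $k$-walk is a sequence $(v_1\dots v_k)$ with $v_1\to\dots\to v_k$. A $P$-coloring of the $k$-walks is a map $c$ from $k$-walks to $P$ with $c(v_1\dots v_k)\not\le c(v_2\dots v_{k+1})$ for every $(k+1)$-walk $(v_1\dots v_{k+1})$. -}

module Defs where

open import Level using (Level; 0ℓ)
open import Data.Nat using (ℕ; zero; suc; _≤_)
open import Data.Fin using (Fin)
open import Data.Vec using (Vec; []; _∷_; head; tail; init)
open import Data.Unit using (⊤)
open import Data.Bool using (Bool; T)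
open import Data.Product using (_×_; Σ)
open import Relation.Nullary using (¬_)
open import Relation.Binary.PropositionalEquality using (_≡_)
open import Relation.Binary.Structures using (IsPartialOrder)

record Digraph : Set₁ where
  field
    n     : ℕ
    edge  : Fin n → Fin n → Bool
    loopless : ∀ {u v} → T (edge u v) → ¬ (u ≡ v)

record FinPoset : Set₁ where
  field
    m     : ℕ
    _≤P_  : Fin m → Fin m → Set
    isPO  : IsPartialOrder _≡_ _≤P_

IsWalk : (G : Digraph) → ∀ {k} → Vec (Fin (Digraph.n G)) k → Set
IsWalk G []           = ⊤
IsWalk G (v ∷ [])     = ⊤
IsWalk G (u ∷ v ∷ vs) = T (Digraph.edge G u v) × IsWalk G (v ∷ vs)

Walk : Digraph → ℕ → Set
Walk G k = Σ (Vec (Fin (Digraph.n G)) k) (IsWalk G)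

IsPColoring : (G : Digraph) (P : FinPoset) (k : ℕ) →
              ((w : Vec (Fin (Digraph.n G)) k) → IsWalk G w → Fin (FinPoset.m P)) → Set
IsPColoring G P k c =
  (w : Vec (Fin (Digraph.n G)) (suc k)) (iw : IsWalk G w) →
  (iw₁ : IsWalk G (init w)) (iw₂ : IsWalk G (tail w)) →
    ¬ (FinPoset._≤P_ P (c (init w) iw₁) (c (tail w) iw₂))

PColorable : Digraph → FinPoset → ℕ → Set
PColorable G P k =
  Σ ((w : Vec (Fin (Digraph.n G)) k) → IsWalk G w → Fin (FinPoset.m P))
    (IsPColoring G P k)

{-# OPTIONS --safe #-}
module Submission where

open import Defs
open import Data.Nat using (ℕ; suc; _≤_)
open import Data.Nat.Base using (_≤′_; ≤′-refl; ≤′-step)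
open import Data.Nat.Properties using (≤⇒≤′)
open import Data.Vec using (Vec; []; _∷_; init; tail)
open import Data.Fin using (Fin)
open import Data.Unit using (tt)
open import Data.Product using (_,_)

module _ (G : Digraph) where

  private
    V : Set
    V = Fin (Digraph.n G)

  isWalk-init : ∀ {k} (w : Vec V (suc k)) → IsWalk G w → IsWalk G (init w)
  isWalk-init (x ∷ [])         _        = tt
  isWalk-init (x ∷ y ∷ [])     _        = tt
  isWalk-init (x ∷ y ∷ z ∷ ws) (e , iw) = e , isWalk-init (y ∷ z ∷ ws) iw

  -- Colour a (k+1)-walk by its k-prefix: for consecutive (k+1)-walks these
  -- prefixes are themselves consecutive k-walks, since tail (init w) reduces
  -- to init (tail w).
  pColorable-suc : ∀ P k → PColorable G P k → PColorable G P (suc k)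
  pColorable-suc P k (c , proper) = c′ , proper′
    where
    c′ : (w : Vec V (suc k)) → IsWalk G w → Fin (FinPoset.m P)
    c′ w iw = c (init w) (isWalk-init w iw)

    proper′ : IsPColoring G P (suc k) c′
    proper′ (x ∷ xs) iw iw₁ iw₂ =
      proper (init (x ∷ xs)) (isWalk-init (x ∷ xs) iw)
             (isWalk-init (init (x ∷ xs)) iw₁) (isWalk-init xs iw₂)

  pColorable-mono : ∀ P {k k′} → k ≤′ k′ → PColorable G P k → PColorable G P k′
  pColorable-mono P ≤′-refl              pc = pc
  pColorable-mono P (≤′-step {k′} k≤′k′) pc =
    pColorable-suc P k′ (pColorable-mono P k≤′k′ pc)

mainTheorem6 : (G : Digraph) (P : FinPoset) (k : ℕ) → 1 ≤ k →
    PColorable G P k → (k' : ℕ) → k ≤ k' → PColorable G P k'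
mainTheorem6 G P k _ pc k' k≤k' = pColorable-mono G P (≤⇒≤′ k≤k') pc
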